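{- Work in $\mathbf{CZF}+\mathbf{REA}$, with the relations $\mathsf{Set}_\alpha(n)$ and $n\,\varepsilon_\alpha\,m$ on $\mathbb{N}$ defined below. (i) For all $m\in\mathbb{N}$ and ordinals $\alpha\subseteq\rho$, if $\mathsf{Set}_\alpha(m)$ then $\mathsf{Set}_\rho(m)$. (ii) For all $m\in\mathbb{N}$ and ordinals $\alpha,\rho$, if $\mathsf{Set}_\alpha(m)$ and $\mathsf{Set}_\rho(m)$, then for all $i\in\mathbb{N}$, $i\,\varepsilon_\alpha\,m\leftrightarrow i\,\varepsilon_\rho\,m$.
   Context: Ordinals are transitive sets of transitive sets. $\mathfrak p$ is a primitive recursive bijective pairing $\mathbb{N}\times\mathbb{N}\to\mathbb{N}$ with inverses $\mathfrak p_0,\mathfrak p_1$; $\mathfrak p(n,m,k):=\mathfrak p(\mathfrak p(n,m),k)$ etc.; $\ell$ and $(x)_j$ are length and component of a bijective coding of finite lists; $\{e\}(n)$ is Kleene application, $\{e\}(a,b):=\{\{e\}(a)\}(b)$. Codes: $\mathsf n_0=\mathfrak p(0,0)$, $\mathsf n_1=\mathfrak p(0,1)$, $\mathsf n=\mathfrak p(0,2)$, $\widetilde\Sigma(a,b)=\mathfrak p(1,\mathfrak p(a,b))$, $\widetilde\Pi(a,b)=\mathfrak p(2,\mathfrak p(a,b))$, $+(a,b)=\mathfrak p(3,\mathfrak p(a,b))$, $\mathsf{list}(a)=\mathfrak p(4,a)$, $\mathsf{id}(a,b,c)=\mathfrak p(5,\mathfrak p(a,b,c))$, $a\widetilde\triangleleft_{c,d,e}b=\mathfrak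 p(6,\mathfrak p(a,b,c,d,e))$, $\widetilde{\mathsf{rf}}(a,r)=\mathfrak p(7,\mathfrak p(a,r))$, $\widetilde{\mathsf{tr}}(a,j,r)=\mathfrak p(8,\mathfrak p(a,j,r))$. By simultaneous transfinite recursion on ordinals $\alpha$ define $\mathsf{Set}_\alpha$ and $\varepsilon_\alpha$, writing $\mathsf{Fam}_\beta(e,k)$ for $\mathsf{Set}_\beta(k)\wedge\forall j(j\,\varepsilon_\beta\,k\to\mathsf{Set}_\beta(\{e\}(j)))$ and $\mathsf{Fam}_{\in\alpha}$, $\mathsf{Set}_{\in\alpha}$ for "for some $\beta\in\alpha$": (1) $\mathsf{Set}_\alpha(\mathsf n_j)$ for $j=0,1$, and $m\,\varepsilon_\alpha\,\mathsf n_j$ iff $m<j$; (2) $\mathsf{Set}_\alpha(\mathsf n)$ and $m\,\varepsilon_\alpha\,\mathsf n$ for all $m\in\mathbb{N}$; (3) if $\mathsf{Fam}_{\in\alpha}(e,k)$ then $\mathsf{Set}_\alpha(\widetilde\Pi(k,e))$ and $\mathsf{Set}_\alpha(\widetilde\Sigma(k,e))$, with $n\,\varepsilon_\alpha\,\widetilde\Pi(k,e)$ iff for some $\beta\in\alpha$, $\mathsf{Fam}_\beta(e,k)$ and $\forall i(i\,\varepsilon_\beta\,k\to\{n\}(i)\,\varepsilon_\beta\,\{e\}(i))$, and $n\,\varepsilon_\alpha\,\widetilde\Sigma(k,e)$ iff for some $\beta\in\alpha$, $\mathsf{Fam}_\beta(e,k)$, $\mathfrak p_0(n)\,\varepsilon_\beta\,k$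 and $\mathfrak p_1(n)\,\varepsilon_\beta\,\{e\}(\mathfrak p_0(n))$; (4) if some $\beta\in\alpha$ has $\mathsf{Set}_\beta(n),\mathsf{Set}_\beta(m)$ then $\mathsf{Set}_\alpha(+(n,m))$, and $i\,\varepsilon_\alpha+(n,m)$ iff for some such $\beta$, $(\mathfrak p_0(i)=0\wedge\mathfrak p_1(i)\,\varepsilon_\beta\,n)\vee(\mathfrak p_0(i)=1\wedge\mathfrak p_1(i)\,\varepsilon_\beta\,m)$; (5) if $\mathsf{Set}_{\in\alpha}(n)$ then $\mathsf{Set}_\alpha(\mathsf{list}(n))$, and $i\,\varepsilon_\alpha\,\mathsf{list}(n)$ iff for some $\beta\in\alpha$ with $\mathsf{Set}_\beta(n)$, $(i)_j\,\varepsilon_\beta\,n$ for all $j<\ell(i)$; (6) if $\mathsf{Set}_{\in\alpha}(n)$ then $\mathsf{Set}_\alpha(\mathsf{id}(n,m,k))$, and $t\,\varepsilon_\alpha\,\mathsf{id}(n,m,k)$ iff for some $\beta\in\alpha$, $\mathsf{Set}_\beta(n)$, $m\,\varepsilon_\beta\,n$ and $t=m=k$; (7) for $\beta\in\alpha$ let $*_\beta$ mean: $\mathsf{Set}_\beta(s)$, $a\,\varepsilon_\beta\,s$, $\mathsf{Fam}_\beta(v,s)$, $\mathsf{Fam}_\beta(i,s)$, and $\forall x,y(x\,\varepsilon_\beta\,s\wedge y\,\varepsilon_\beta\,\{i\}(x)\to\mathsf{Fam}_\beta(\{c\}(x,y),s))$; if $*_\beta$ for some $\beta\in\alpha$ then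 $\mathsf{Set}_\alpha(a\widetilde\triangleleft_{s,i,c}v)$; for such $\beta$ let $V_\beta$ be the smallest subset of $\mathbb{N}$ such that (a) if $z\,\varepsilon_\beta\,s$ and $r\,\varepsilon_\beta\,\{v\}(z)$ then $\mathfrak p(z,\widetilde{\mathsf{rf}}(z,r))\in V_\beta$, and (b) if $r\in\mathbb{N}$, $z\,\varepsilon_\beta\,s$, $j\,\varepsilon_\beta\,\{i\}(z)$ and for all $u\,\varepsilon_\beta\,s$ and $t\,\varepsilon_\beta\,\{c\}(z,j,u)$ we have $\mathfrak p(u,\{r\}(u,t))\in V_\beta$, then $\mathfrak p(z,\widetilde{\mathsf{tr}}(z,j,r))\in V_\beta$ (this set exists by $\mathbf{REA}$); then $q\,\varepsilon_\alpha\,a\widetilde\triangleleft_{s,i,c}v$ iff for some $\beta\in\alpha$, $*_\beta$ and $\mathfrak p(a,q)\in V_\beta$. Nothing else is in $\mathsf{Set}_\alpha$ or $\varepsilon_\alpha$. -}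

module Defs where

open import Data.Nat using (ℕ; zero; suc; _+_; _<_)
open import Data.Nat.Properties using (_≟_)
open import Data.List using (List; []; _∷_; length)
open import Data.Product using (Σ; _×_; _,_; proj₁; proj₂)
open import Data.Sum using (_⊎_)
open import Relation.Binary.PropositionalEquality using (_≡_)
open import Relation.Nullary using (yes; no)

tri : ℕ → ℕ
tri zero    = zero
tri (suc k) = suc k + tri k

pair : ℕ → ℕ → ℕ
pair n m = tri (n + m) + m

-- inverse, by enumerating the pairs in the order of 𝔭
unpair : ℕ → ℕ × ℕ
unpair zero    = 0 , 0
unpair (suc k) with unpair k
... | zero  , b = suc b , 0
... | suc a , b = a , suc b

p₀ p₁ : ℕ → ℕ
p₀ k = proj₁ (unpair k)
p₁ k = proj₂ (unpair k)

pair3 : ℕ → ℕ → ℕ → ℕ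
pair3 a b c = pair (pair a b) c

pair5 : ℕ → ℕ → ℕ → ℕ → ℕ → ℕ
pair5 a b c d e = pair (pair (pair (pair a b) c) d) e

-- Bijective coding of finite lists:  [] ↦ 0,  x ∷ xs ↦ 1 + 𝔭(x, code xs)

decodeF : ℕ → ℕ → List ℕ
decodeF zero    _       = []
decodeF (suc f) zero    = []
decodeF (suc f) (suc k) = p₀ k ∷ decodeF f (p₁ k)

decode : ℕ → List ℕ
decode k = decodeF k k

nth : List ℕ → ℕ → ℕ
nth []       _       = 0
nth (x ∷ xs) zero    = x
nth (x ∷ xs) (suc j) = nth xs j

len : ℕ → ℕ
len i = length (decode i)

comp : ℕ → ℕ → ℕ
comp i j = nth (decode i) j

-- Kleene application, via a standard (acceptable) numbering of the
-- μ-recursive functions.  Eval e xs y : "φ_e(xs) ≃ y".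
--   𝔭(0,0)          : constant zero
--   𝔭(1,0)          : successor of the first argument
--   𝔭(2,i)          : i-th projection
--   𝔭(3,𝔭(f,gs))    : composition f(g_1(xs),…,g_k(xs)), gs a list code
--   𝔭(4,𝔭(g,h))     : primitive recursion on the first argument
--   𝔭(5,f)          : minimisation  μy. f(y,xs) = 0

mutual
  data Eval : ℕ → List ℕ → ℕ → Set where
    zeroF : ∀ {e xs} → e ≡ pair 0 0 → Eval e xs 0
    succF : ∀ {e x xs} → e ≡ pair 1 0 → Eval e (x ∷ xs) (suc x)
    projF : ∀ {e xs i} → e ≡ pair 2 i → i < length xs → Eval e xs (nth xs i)
    compF : ∀ {e xs f gs ys y} → e ≡ pair 3 (pair f gs) →
            EvalAll (decode gs) xs ys → Eval f ys y → Eval e xs y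
    primZ : ∀ {e xs g h y} → e ≡ pair 4 (pair g h) →
            Eval g xs y → Eval e (0 ∷ xs) y
    primS : ∀ {e xs g h n y z} → e ≡ pair 4 (pair g h) →
            Eval e (n ∷ xs) y → Eval h (n ∷ y ∷ xs) z → Eval e (suc n ∷ xs) z
    minF  : ∀ {e xs f y} → e ≡ pair 5 f → Eval f (y ∷ xs) 0 →
            (∀ k → k < y → Σ ℕ λ w → Eval f (k ∷ xs) (suc w)) → Eval e xs y

  data EvalAll : List ℕ → List ℕ → List ℕ → Set where
    []  : ∀ {xs} → EvalAll [] xs []
    _∷_ : ∀ {g gs xs y ys} → Eval g xs y → EvalAll gs xs ys → EvalAll (g ∷ gs) xs (y ∷ ys)

App : ℕ → ℕ → ℕ → Set
App e n w = Eval e (n ∷ []) w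

App2 : ℕ → ℕ → ℕ → ℕ → Set
App2 e a b w = Σ ℕ λ x → App e a x × App x b w

App3 : ℕ → ℕ → ℕ → ℕ → ℕ → Set
App3 e a b c w = Σ ℕ λ x → App2 e a b x × App x c w

𝗇₀ 𝗇₁ 𝗇 : ℕ
𝗇₀ = pair 0 0
𝗇₁ = pair 0 1
𝗇  = pair 0 2

Σ̃ Π̃ plusC : ℕ → ℕ → ℕ
Σ̃ a b     = pair 1 (pair a b)
Π̃ a b     = pair 2 (pair a b)
plusC a b = pair 3 (pair a b)

listC : ℕ → ℕ
listC a = pair 4 a

idC : ℕ → ℕ → ℕ → ℕ
idC a b c = pair 5 (pair3 a b c)

triC : ℕ → ℕ → ℕ → ℕ → ℕ → ℕ
triC a b c d e = pair 6 (pair5 a b c d e)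

rfC : ℕ → ℕ → ℕ
rfC a r = pair 7 (pair a r)

trC : ℕ → ℕ → ℕ → ℕ
trC a j r = pair 8 (pair3 a j r)

-- Aczel's interpretation of CZF: sets as well-founded trees

data 𝕍 : Set₁ where
  sup : (A : Set) → (A → 𝕍) → 𝕍

_≐_ : 𝕍 → 𝕍 → Set
sup A f ≐ sup B g = (∀ a → Σ B λ b → f a ≐ g b) × (∀ b → Σ A λ a → f a ≐ g b)

_∈_ : 𝕍 → 𝕍 → Set
x ∈ sup A f = Σ A λ a → x ≐ f a

_⊆_ : 𝕍 → 𝕍 → Set₁
x ⊆ y = ∀ z → z ∈ x → z ∈ y

Transitive : 𝕍 → Set₁
Transitive x = ∀ y → y ∈ x → y ⊆ x

Ordinal : 𝕍 → Set₁
Ordinal x = Transitive x × (∀ y → y ∈ x → Transitive y)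

-- A "level": the pair of relations Set_β, ε_β

record Lvl : Set₁ where
  field
    S : ℕ → Set
    E : ℕ → ℕ → Set      -- E m n  :  m ε_β n
open Lvl public

module _ (L : Lvl) where
  SetApp : ℕ → ℕ → Set
  SetApp e j = Σ ℕ λ w → App e j w × S L w

  EpsApp : ℕ → ℕ → ℕ → Set
  EpsApp t e j = Σ ℕ λ w → App e j w × E L t w

  Fam : ℕ → ℕ → Set
  Fam e k = S L k × (∀ j → E L j k → SetApp e j)

  Star : ℕ → ℕ → ℕ → ℕ → ℕ → Set
  Star a s i c v =
    S L s × E L a s × Fam v s × Fam i s ×
    (∀ x y → E L x s → EpsApp y i x →
       Σ ℕ λ w → App2 c x y w × Fam w s)

  data Vset (s i c v : ℕ) : ℕ → Set where
    vrf : ∀ {x} z r → x ≡ pair z (rfC z r) →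
          E L z s → EpsApp r v z → Vset s i c v x
    vtr : ∀ {x} r z j → x ≡ pair z (trC z j r) →
          E L z s → EpsApp j i z →
          (∀ u t → E L u s → (Σ ℕ λ w → App3 c z j u w × E L t w) →
             Σ ℕ λ w → App2 r u t w × Vset s i c v (pair u w)) →
          Vset s i c v x

-- Set_α from the levels β ∈ α (indexed by A)
data SetS (A : Set) (L : A → Lvl) : ℕ → Set where
  sN₀  : ∀ {m} → m ≡ 𝗇₀ → SetS A L m
  sN₁  : ∀ {m} → m ≡ 𝗇₁ → SetS A L m
  sN   : ∀ {m} → m ≡ 𝗇 → SetS A L m
  sΠ   : ∀ {m} (b : A) e k → m ≡ Π̃ k e → Fam (L b) e k → SetS A L m
  sΣ   : ∀ {m} (b : A) e k → m ≡ Σ̃ k e → Fam (L b) e k → SetS A L m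
  s+   : ∀ {m} (b : A) n n' → m ≡ plusC n n' → S (L b) n → S (L b) n' → SetS A L m
  sL   : ∀ {m} (b : A) n → m ≡ listC n → S (L b) n → SetS A L m
  sId  : ∀ {m} (b : A) n m' k → m ≡ idC n m' k → S (L b) n → SetS A L m
  s◁   : ∀ {m} (b : A) a s i c v → m ≡ triC a v s i c →
         Star (L b) a s i c v → SetS A L m

data EpsS (A : Set) (L : A → Lvl) : ℕ → ℕ → Set where
  eN₀ : ∀ {t m} → m ≡ 𝗇₀ → t < 0 → EpsS A L t m
  eN₁ : ∀ {t m} → m ≡ 𝗇₁ → t < 1 → EpsS A L t m
  eN  : ∀ {t m} → m ≡ 𝗇 → EpsS A L t m
  eΠ  : ∀ {t m} (b : A) e k → m ≡ Π̃ k e → Fam (L b) e k →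
        (∀ i → E (L b) i k →
           Σ ℕ λ x → App t i x × EpsApp (L b) x e i) →
        EpsS A L t m
  eΣ  : ∀ {t m} (b : A) e k → m ≡ Σ̃ k e → Fam (L b) e k →
        E (L b) (p₀ t) k → EpsApp (L b) (p₁ t) e (p₀ t) →
        EpsS A L t m
  e+  : ∀ {t m} (b : A) n n' → m ≡ plusC n n' → S (L b) n → S (L b) n' →
        ((p₀ t ≡ 0 × E (L b) (p₁ t) n) ⊎ (p₀ t ≡ 1 × E (L b) (p₁ t) n')) →
        EpsS A L t m
  eL  : ∀ {t m} (b : A) n → m ≡ listC n → S (L b) n →
        (∀ j → j < len t → E (L b) (comp t j) n) → EpsS A L t m
  eId : ∀ {t m} (b : A) n m' k → m ≡ idC n m' k → S (L b) n →
        E (L b) m' n → t ≡ m' → m' ≡ k → EpsS A L t m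
  e◁  : ∀ {t m} (b : A) a s i c v → m ≡ triC a v s i c →
        Star (L b) a s i c v → Vset (L b) s i c v (pair a t) →
        EpsS A L t m

lvl : 𝕍 → Lvl
lvl (sup A f) = record { S = SetS A (λ b → lvl (f b)) ; E = EpsS A (λ b → lvl (f b)) }

Setα : 𝕍 → ℕ → Set
Setα α n = S (lvl α) n

εα : 𝕍 → ℕ → ℕ → Set
εα α n m = E (lvl α) n m

-- (i)  Set_α(m) only depends on the levels Set_β, ε_β for β ∈ α, and these in
--      turn only depend on β up to extensional equality ≐.  So we show that the
--      level of a set is invariant under ≐ (lvl-cong); α ⊆ ρ then lets every
--      clause of Set_α be replayed at Set_ρ with an equivalent level β' ∈ ρ.
-- (ii) The codes of the clauses are injective (𝔭 is a bijection) and Kleene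
--      application is deterministic.  Hence if m is a set at α and at ρ, both
--      witnesses were built by the same clause from the same components, and by
--      induction on α and ρ simultaneously, members of the components agree at
--      the two levels; this transfers every clause of ε_α to ε_ρ (agree).
-- Neither part uses that α, ρ are ordinals: both hold for arbitrary sets.
module Submission where

open import Defs
open import Data.Nat using (ℕ; zero; suc; _+_; _<_)
open import Data.Nat.Properties using (+-suc; +-identityʳ; +-comm; <-cmp; suc-injective; 0≢1+n)
open import Data.Product using (Σ; _×_; _,_; proj₁; proj₂; map₂; map₂′)
open import Data.Product.Properties using (,-injective)
open import Data.Sum using () renaming (map to ⊎-map)
open import Data.Empty using (⊥-elim)
open import Data.List using (List; _∷_)
open import Relation.Binary.PropositionalEquality
  using (_≡_; refl; sym; trans; cong; cong₂; module ≡-Reasoning)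
open import Relation.Binary.Definitions using (tri<; tri≈; tri>)

pair-suc-zero : ∀ a → pair (suc a) 0 ≡ suc (pair 0 a)
pair-suc-zero a = begin
  tri (suc a + 0) + 0  ≡⟨ +-identityʳ _ ⟩
  tri (suc a + 0)      ≡⟨ cong tri (+-identityʳ (suc a)) ⟩
  suc (a + tri a)      ≡⟨ cong suc (+-comm a (tri a)) ⟩
  suc (tri a + a)      ∎
  where open ≡-Reasoning

pair-suc-right : ∀ a b → pair a (suc b) ≡ suc (pair (suc a) b)
pair-suc-right a b = begin
  tri (a + suc b) + suc b      ≡⟨ cong (λ n → tri n + suc b) (+-suc a b) ⟩
  tri (suc (a + b)) + suc b    ≡⟨ +-suc _ b ⟩
  suc (tri (suc (a + b)) + b)  ∎
  where open ≡-Reasoning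

unpair-next-diagonal : ∀ {k a} → unpair k ≡ (0 , a) → unpair (suc k) ≡ (suc a , 0)
unpair-next-diagonal eq rewrite eq = refl

unpair-along-diagonal : ∀ {k a b} → unpair k ≡ (suc a , b) → unpair (suc k) ≡ (a , suc b)
unpair-along-diagonal eq rewrite eq = refl

unpair-pair-diagonal : ∀ n a b → a + b ≡ n → unpair (pair a b) ≡ (a , b)
unpair-pair-diagonal _       zero    zero    _  = refl
unpair-pair-diagonal zero    (suc a) zero    ()
unpair-pair-diagonal (suc n) (suc a) zero    eq =
  trans (cong unpair (pair-suc-zero a)) (unpair-next-diagonal {pair 0 a}
    (unpair-pair-diagonal n 0 a (trans (sym (+-identityʳ a)) (suc-injective eq))))
unpair-pair-diagonal n       a       (suc b) eq =
  trans (cong unpair (pair-suc-right a b)) (unpair-along-diagonal {pair (suc a) b}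
    (unpair-pair-diagonal n (suc a) b (trans (sym (+-suc a b)) eq)))

unpair-pair : ∀ a b → unpair (pair a b) ≡ (a , b)
unpair-pair a b = unpair-pair-diagonal (a + b) a b refl

pair-injective : ∀ {a b c d} → pair a b ≡ pair c d → a ≡ c × b ≡ d
pair-injective {a} {b} {c} {d} eq = ,-injective (begin
  (a , b)            ≡⟨ sym (unpair-pair a b) ⟩
  unpair (pair a b)  ≡⟨ cong unpair eq ⟩
  unpair (pair c d)  ≡⟨ unpair-pair c d ⟩
  (c , d)            ∎)
  where open ≡-Reasoning

-- Two presentations m = 𝔭(k, a) = 𝔭(k', a') of a code agree: this is how a
-- code determines the clause (k) and its parameters (a) that produced it.
code-injective : ∀ {m} k a k' a' → m ≡ pair k a → m ≡ pair k' a' → k ≡ k' × a ≡ a'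
code-injective _ _ _ _ p q = pair-injective (trans (sym p) q)

pair3-injective : ∀ {a b c a' b' c'} → pair3 a b c ≡ pair3 a' b' c' →
                  a ≡ a' × b ≡ b' × c ≡ c'
pair3-injective {a} {b} {c} {a'} {b'} {c'} eq
  with pair-injective {pair a b} {c} {pair a' b'} {c'} eq
... | ab≡ , refl with pair-injective {a} {b} {a'} {b'} ab≡
... | refl , refl = refl , refl , refl

pair5-injective : ∀ {a b c d e a' b' c' d' e'} →
                  pair5 a b c d e ≡ pair5 a' b' c' d' e' →
                  a ≡ a' × b ≡ b' × c ≡ c' × d ≡ d' × e ≡ e'
pair5-injective {a} {b} {c} {d} {e} {a'} {b'} {c'} {d'} {e'} eq
  with pair-injective {pair3 (pair a b) c d} {e} {pair3 (pair a' b') c' d'} {e'} eq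
... | abcd≡ , refl with pair-injective {pair (pair a b) c} {d} {pair (pair a' b') c'} {d'} abcd≡
... | abc≡ , refl with pair3-injective {a} {b} {c} {a'} {b'} {c'} abc≡
... | refl , refl , refl = refl , refl , refl , refl , refl

-- The last rule of an evaluation of the program e = 𝔭(k, a), indexed by the
-- rule number k, together with the premises that determine its result.
-- Indexing by the literal k makes the rules of distinct numbers disjoint.
data Step (e : ℕ) : ℕ → ℕ → List ℕ → ℕ → Set where
  zeroS  : ∀ {a xs} → Step e 0 a xs 0
  succS  : ∀ {a x xs} → Step e 1 a (x ∷ xs) (suc x)
  projS  : ∀ {i xs} → Step e 2 i xs (nth xs i)
  compS  : ∀ {a f gs xs ys y} → a ≡ pair f gs →
           EvalAll (decode gs) xs ys → Eval f ys y → Step e 3 a xs y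
  primZS : ∀ {a g h xs y} → a ≡ pair g h → Eval g xs y → Step e 4 a (0 ∷ xs) y
  primSS : ∀ {a g h n xs y z} → a ≡ pair g h →
           Eval e (n ∷ xs) y → Eval h (n ∷ y ∷ xs) z → Step e 4 a (suc n ∷ xs) z
  minS   : ∀ {f xs y} → Eval f (y ∷ xs) 0 →
           (∀ k → k < y → Σ ℕ λ w → Eval f (k ∷ xs) (suc w)) → Step e 5 f xs y

step : ∀ {e xs y} k a → Eval e xs y → e ≡ pair k a → Step e k a xs y
step k a (zeroF p) q with code-injective 0 0 k a p q
... | refl , _ = zeroS
step k a (succF p) q with code-injective 1 0 k a p q
... | refl , _ = succS
step k a (projF {i = i} p _) q with code-injective 2 i k a p q
... | refl , refl = projS
step k a (compF {f = f} {gs = gs} p fs f↓) q with code-injective 3 (pair f gs) k a p q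
... | refl , a≡ = compS {f = f} {gs = gs} (sym a≡) fs f↓
step k a (primZ {g = g} {h = h} p g↓) q with code-injective 4 (pair g h) k a p q
... | refl , a≡ = primZS {g = g} {h = h} (sym a≡) g↓
step k a (primS {g = g} {h = h} p r h↓) q with code-injective 4 (pair g h) k a p q
... | refl , a≡ = primSS {g = g} {h = h} (sym a≡) r h↓
step k a (minF {f = f} p f0 below) q with code-injective 5 f k a p q
... | refl , refl = minS f0 below

mutual
  det : ∀ {e xs y y'} → Eval e xs y → Eval e xs y' → y ≡ y'
  det (zeroF p) d' with step 0 0 d' p
  ... | zeroS = refl
  det (succF p) d' with step 1 0 d' p
  ... | succS = refl
  det (projF {i = i} p _) d' with step 2 i d' p
  ... | projS = refl
  det (compF {f = f} {gs = gs} p fs f↓) d' with step 3 (pair f gs) d' p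
  ... | compS {f = f'} {gs = gs'} q fs' f↓' with pair-injective {f} {gs} {f'} {gs'} q
  ... | refl , refl with det-all fs fs'
  ... | refl = det f↓ f↓'
  det (primZ {g = g} {h = h} p g↓) d' with step 4 (pair g h) d' p
  ... | primZS {g = g'} {h = h'} q g↓' with pair-injective {g} {h} {g'} {h'} q
  ... | refl , refl = det g↓ g↓'
  det (primS {g = g} {h = h} p r h↓) d' with step 4 (pair g h) d' p
  ... | primSS {g = g'} {h = h'} q r' h↓' with pair-injective {g} {h} {g'} {h'} q
  ... | refl , refl with det r r'
  ... | refl = det h↓ h↓'
  -- minimisation: neither least zero can lie below the other
  det (minF {f = f} {y = y} p f0 below) d' with step 5 f d' p
  ... | minS {y = y'} f0' below' with <-cmp y y'
  ... | tri< y<y' _ _ = ⊥-elim (0≢1+n (det f0 (proj₂ (below' y y<y'))))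
  ... | tri≈ _ y≡y' _ = y≡y'
  ... | tri> _ _ y'<y = ⊥-elim (0≢1+n (sym (det (proj₂ (below y' y'<y)) f0')))

  det-all : ∀ {gs xs ys ys'} → EvalAll gs xs ys → EvalAll gs xs ys' → ys ≡ ys'
  det-all []       []         = refl
  det-all (d ∷ ds) (d' ∷ ds') = cong₂ _∷_ (det d d') (det-all ds ds')

det2 : ∀ {e a b w w'} → App2 e a b w → App2 e a b w' → w ≡ w'
det2 (x , ex , xw) (x' , ex' , xw') with det ex ex'
... | refl = det xw xw'

EpsApp3 : Lvl → ℕ → ℕ → ℕ → ℕ → ℕ → Set
EpsApp3 L t c z j u = Σ ℕ λ w → App3 c z j u w × E L t w

-- V_β grows when ε_β grows on s, {v}(z), {i}(z) and shrinks on {c}(z,j,u);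
-- s occurs both positively and negatively in clause (b), so it must be fixed.
Vset-map : ∀ {L L' s i c v} →
  (∀ {z} → E L z s → E L' z s) →
  (∀ {z} → E L' z s → E L z s) →
  (∀ {z r} → E L z s → EpsApp L r v z → EpsApp L' r v z) →
  (∀ {z j} → E L z s → EpsApp L j i z → EpsApp L' j i z) →
  (∀ {z j u t} → E L z s → EpsApp L j i z → E L u s →
     EpsApp3 L' t c z j u → EpsApp3 L t c z j u) →
  ∀ {x} → Vset L s i c v x → Vset L' s i c v x
Vset-map s⇒ s⇐ v⇒ i⇒ c⇐ (vrf z r eq z∈s r∈vz) = vrf z r eq (s⇒ z∈s) (v⇒ z∈s r∈vz)
Vset-map s⇒ s⇐ v⇒ i⇒ c⇐ (vtr r z j eq z∈s j∈iz below) =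
  vtr r z j eq (s⇒ z∈s) (i⇒ z∈s j∈iz) λ u t u∈s t∈c →
    let (w , app , w∈V) = below u t (s⇐ u∈s) (c⇐ z∈s j∈iz (s⇐ u∈s) t∈c)
    in w , app , Vset-map s⇒ s⇐ v⇒ i⇒ c⇐ w∈V

record _≈ᴸ_ (L L' : Lvl) : Set where
  field
    to-S   : ∀ {n} → S L n → S L' n
    from-S : ∀ {n} → S L' n → S L n
    to-E   : ∀ {t n} → E L t n → E L' t n
    from-E : ∀ {t n} → E L' t n → E L t n
open _≈ᴸ_

≈ᴸ-sym : ∀ {L L'} → L ≈ᴸ L' → L' ≈ᴸ L
≈ᴸ-sym q = record { to-S = from-S q ; from-S = to-S q ; to-E = from-E q ; from-E = to-E q }

SetApp-≈ : ∀ {L L' e j} → L ≈ᴸ L' → SetApp L e j → SetApp L' e j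
SetApp-≈ q = map₂ (map₂ (to-S q))

EpsApp-≈ : ∀ {L L' x e j} → L ≈ᴸ L' → EpsApp L x e j → EpsApp L' x e j
EpsApp-≈ q = map₂ (map₂ (to-E q))

Fam-≈ : ∀ {L L' e k} → L ≈ᴸ L' → Fam L e k → Fam L' e k
Fam-≈ q (k-set , fam) = to-S q k-set , λ j j∈k → SetApp-≈ q (fam j (from-E q j∈k))

Star-≈ : ∀ {L L' a s i c v} → L ≈ᴸ L' → Star L a s i c v → Star L' a s i c v
Star-≈ q (s-set , a∈s , v-fam , i-fam , c-fam) =
  to-S q s-set , to-E q a∈s , Fam-≈ q v-fam , Fam-≈ q i-fam ,
  λ x y x∈s y∈ix →
    let (w , app , w-fam) = c-fam x y (from-E q x∈s) (EpsApp-≈ (≈ᴸ-sym q) y∈ix)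
    in w , app , Fam-≈ q w-fam

Vset-≈ : ∀ {L L' s i c v x} → L ≈ᴸ L' → Vset L s i c v x → Vset L' s i c v x
Vset-≈ q = Vset-map (to-E q) (from-E q) (λ _ → EpsApp-≈ q) (λ _ → EpsApp-≈ q)
                    (λ _ _ _ → map₂ (map₂ (from-E q)))

Simulates : ∀ {A B : Set} → (A → Lvl) → (B → Lvl) → Set
Simulates {A} {B} L L' = ∀ a → Σ B λ b → L a ≈ᴸ L' b

SetS-mono : ∀ {A B L L' n} → Simulates {A} {B} L L' → SetS A L n → SetS B L' n
SetS-mono sim (sN₀ p) = sN₀ p
SetS-mono sim (sN₁ p) = sN₁ p
SetS-mono sim (sN p)  = sN p
SetS-mono sim (sΠ a e k p fam) = let (b , q) = sim a in sΠ b e k p (Fam-≈ q fam)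
SetS-mono sim (sΣ a e k p fam) = let (b , q) = sim a in sΣ b e k p (Fam-≈ q fam)
SetS-mono sim (s+ a n n' p n-set n'-set) =
  let (b , q) = sim a in s+ b n n' p (to-S q n-set) (to-S q n'-set)
SetS-mono sim (sL a n p n-set) = let (b , q) = sim a in sL b n p (to-S q n-set)
SetS-mono sim (sId a n m k p n-set) = let (b , q) = sim a in sId b n m k p (to-S q n-set)
SetS-mono sim (s◁ a a' s i c v p star) = let (b , q) = sim a in s◁ b a' s i c v p (Star-≈ q star)

EpsS-mono : ∀ {A B L L' t n} → Simulates {A} {B} L L' → EpsS A L t n → EpsS B L' t n
EpsS-mono sim (eN₀ p t<0) = eN₀ p t<0
EpsS-mono sim (eN₁ p t<1) = eN₁ p t<1
EpsS-mono sim (eN p)      = eN p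
EpsS-mono sim (eΠ a e k p fam members) = let (b , q) = sim a in
  eΠ b e k p (Fam-≈ q fam) λ j j∈k →
    let (x , app , x∈) = members j (from-E q j∈k) in x , app , EpsApp-≈ q x∈
EpsS-mono sim (eΣ a e k p fam p₀t∈k p₁t∈) = let (b , q) = sim a in
  eΣ b e k p (Fam-≈ q fam) (to-E q p₀t∈k) (EpsApp-≈ q p₁t∈)
EpsS-mono sim (e+ a n n' p n-set n'-set t∈) = let (b , q) = sim a in
  e+ b n n' p (to-S q n-set) (to-S q n'-set) (⊎-map (map₂ (to-E q)) (map₂ (to-E q)) t∈)
EpsS-mono sim (eL a n p n-set members) = let (b , q) = sim a in
  eL b n p (to-S q n-set) (λ j j<ℓ → to-E q (members j j<ℓ))
EpsS-mono sim (eId a n m k p n-set m∈n t≡m m≡k) = let (b , q) = sim a in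
  eId b n m k p (to-S q n-set) (to-E q m∈n) t≡m m≡k
EpsS-mono sim (e◁ a a' s i c v p star a't∈V) = let (b , q) = sim a in
  e◁ b a' s i c v p (Star-≈ q star) (Vset-≈ q a't∈V)

lvl-cong : ∀ {x y} → x ≐ y → lvl x ≈ᴸ lvl y
lvl-cong {sup A f} {sup B g} (forth , back) = record
  { to-S = SetS-mono sim ; from-S = SetS-mono sim'
  ; to-E = EpsS-mono sim ; from-E = EpsS-mono sim' }
  where
  sim : Simulates (λ a → lvl (f a)) (λ b → lvl (g b))
  sim a = let (b , fa≐gb) = forth a in b , lvl-cong fa≐gb
  sim' : Simulates (λ b → lvl (g b)) (λ a → lvl (f a))
  sim' b = let (a , fa≐gb) = back b in a , ≈ᴸ-sym (lvl-cong fa≐gb)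

≐-refl : ∀ x → x ≐ x
≐-refl (sup A f) = (λ a → a , ≐-refl (f a)) , (λ a → a , ≐-refl (f a))

Set-mono : ∀ {m} α ρ → α ⊆ ρ → Setα α m → Setα ρ m
Set-mono (sup A f) (sup B g) α⊆ρ = SetS-mono sim
  where
  sim : Simulates (λ a → lvl (f a)) (λ b → lvl (g b))
  -- f a ∈ α, hence f a ≐ g b for some b
  sim a = let (b , fa≐gb) = α⊆ρ (f a) (a , ≐-refl (f a)) in b , lvl-cong fa≐gb

Agrees : Lvl → Lvl → Set
Agrees L L' = ∀ {n t} → S L' n → E L t n → E L' t n

-- Given agreement in both directions, the derived notions transfer from Lb to Lg
-- as soon as the relevant sets are sets of Lg; determinism of {e}(j) ensures
-- that both levels speak about the same set.
module Agreement {Lb Lg : Lvl} (R : Agrees Lb Lg) (R' : Agrees Lg Lb) where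

  EpsApp-agree : ∀ {x e j} → SetApp Lg e j → EpsApp Lb x e j → EpsApp Lg x e j
  EpsApp-agree (w' , app' , w'-set) (w , app , x∈w) with det app app'
  ... | refl = w , app , R w'-set x∈w

  Σ-member-agree : ∀ {t e k} → Fam Lg e k →
    E Lb (p₀ t) k → EpsApp Lb (p₁ t) e (p₀ t) →
    E Lg (p₀ t) k × EpsApp Lg (p₁ t) e (p₀ t)
  Σ-member-agree (k-set' , fam') p₀t∈k p₁t∈ =
    R k-set' p₀t∈k , EpsApp-agree (fam' _ (R k-set' p₀t∈k)) p₁t∈

  Π-member-agree : ∀ {t e k} → S Lb k → Fam Lg e k →
    (∀ j → E Lb j k → Σ ℕ λ x → App t j x × EpsApp Lb x e j) →
    (∀ j → E Lg j k → Σ ℕ λ x → App t j x × EpsApp Lg x e j)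
  Π-member-agree k-set (_ , fam') members j j∈k with members j (R' k-set j∈k)
  ... | x , app , x∈ = x , app , EpsApp-agree (fam' j j∈k) x∈

  -- by *_Lb, {c}(z,j) is a family over s at Lb, so each {c}(z,j,u) is a set of Lb
  c-members-back : ∀ {s i c z j u t} →
    (∀ x y → E Lb x s → EpsApp Lb y i x → Σ ℕ λ w → App2 c x y w × Fam Lb w s) →
    E Lb z s → EpsApp Lb j i z → E Lb u s → EpsApp3 Lg t c z j u → EpsApp3 Lb t c z j u
  c-members-back c-fam z∈s j∈iz u∈s (w , (x , cx , xw) , t∈w) with c-fam _ _ z∈s j∈iz
  ... | x' , cx' , (_ , fam) with det2 cx cx'
  ... | refl with fam _ u∈s
  ... | w' , xw' , w'-set with det xw xw'
  ... | refl = w , (x , cx , xw) , R' w'-set t∈w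

  Vset-agree : ∀ {a s i c v x} → Star Lb a s i c v → Star Lg a s i c v →
               Vset Lb s i c v x → Vset Lg s i c v x
  Vset-agree (s-set , _ , _ , _ , c-fam) (s-set' , _ , v-fam' , i-fam' , _) =
    Vset-map (R s-set') (R' s-set)
      (λ z∈s → EpsApp-agree (proj₂ v-fam' _ (R s-set' z∈s)))
      (λ z∈s → EpsApp-agree (proj₂ i-fam' _ (R s-set' z∈s)))
      (c-members-back c-fam)

open Agreement using (Σ-member-agree; Π-member-agree; Vset-agree)

-- The clause by which a set of a level family was formed, indexed by the
-- clause number k of its code 𝔭(k, x); the base sets 𝗇₀, 𝗇₁, 𝗇 share number 0.
data SetShape (A : Set) (L : A → Lvl) : ℕ → ℕ → Set where
  shBase : ∀ {x} → SetShape A L 0 x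
  shΣ    : ∀ {x e k} (b : A) → x ≡ pair k e → Fam (L b) e k → SetShape A L 1 x
  shΠ    : ∀ {x e k} (b : A) → x ≡ pair k e → Fam (L b) e k → SetShape A L 2 x
  sh+    : ∀ {x n n'} (b : A) → x ≡ pair n n' → S (L b) n → S (L b) n' → SetShape A L 3 x
  shL    : ∀ {n} (b : A) → S (L b) n → SetShape A L 4 n
  shId   : ∀ {x n m k} (b : A) → x ≡ pair3 n m k → S (L b) n → SetShape A L 5 x
  sh◁    : ∀ {x a s i c v} (b : A) → x ≡ pair5 a v s i c → Star (L b) a s i c v →
           SetShape A L 6 x

shape : ∀ {A L m} k x → SetS A L m → m ≡ pair k x → SetShape A L k x
shape k x (sN₀ p) q with code-injective 0 0 k x p q
... | refl , _ = shBase
shape k x (sN₁ p) q with code-injective 0 1 k x p q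
... | refl , _ = shBase
shape k x (sN p) q with code-injective 0 2 k x p q
... | refl , _ = shBase
shape k x (sΣ b e k' p fam) q with code-injective 1 (pair k' e) k x p q
... | refl , x≡ = shΣ {e = e} {k = k'} b (sym x≡) fam
shape k x (sΠ b e k' p fam) q with code-injective 2 (pair k' e) k x p q
... | refl , x≡ = shΠ {e = e} {k = k'} b (sym x≡) fam
shape k x (s+ b n n' p n-set n'-set) q with code-injective 3 (pair n n') k x p q
... | refl , x≡ = sh+ {n = n} {n' = n'} b (sym x≡) n-set n'-set
shape k x (sL b n p n-set) q with code-injective 4 n k x p q
... | refl , refl = shL b n-set
shape k x (sId b n m k' p n-set) q with code-injective 5 (pair3 n m k') k x p q
... | refl , x≡ = shId {n = n} {m = m} {k = k'} b (sym x≡) n-set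
shape k x (s◁ b a s i c v p star) q with code-injective 6 (pair5 a v s i c) k x p q
... | refl , x≡ = sh◁ {a = a} {s = s} {i = i} {c = c} {v = v} b (sym x≡) star

-- The ε-clause fixes the code of n; the Set-clause
-- of the target is then the same clause with the same components.
module _ {A B : Set} {L : A → Lvl} {L' : B → Lvl}
         (agrees : ∀ a b → Agrees (L a) (L' b)) (agrees' : ∀ a b → Agrees (L' b) (L a)) where

  EpsS-agree : ∀ {n t} → SetS B L' n → EpsS A L t n → EpsS B L' t n
  EpsS-agree _ (eN₀ _ ())
  EpsS-agree _ (eN₁ p t<1) = eN₁ p t<1
  EpsS-agree _ (eN p)      = eN p
  EpsS-agree {t = t} n-set (eΣ a e k p fam p₀t∈k p₁t∈) with shape 1 (pair k e) n-set p
  ... | shΣ {e = e'} {k = k'} b q fam' with pair-injective {k} {e} {k'} {e'} q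
  ... | refl , refl =
        let (p₀t∈k' , p₁t∈') =
              Σ-member-agree (agrees a b) (agrees' a b) {t = t} fam' p₀t∈k p₁t∈
        in eΣ b e k p fam' p₀t∈k' p₁t∈'
  EpsS-agree n-set (eΠ a e k p fam members) with shape 2 (pair k e) n-set p
  ... | shΠ {e = e'} {k = k'} b q fam' with pair-injective {k} {e} {k'} {e'} q
  ... | refl , refl =
        eΠ b e k p fam' (Π-member-agree (agrees a b) (agrees' a b) (proj₁ fam) fam' members)
  EpsS-agree n-set (e+ a n n' p _ _ t∈) with shape 3 (pair n n') n-set p
  ... | sh+ {n = m} {n' = m'} b q n-set' n'-set' with pair-injective {n} {n'} {m} {m'} q
  ... | refl , refl =
        e+ b n n' p n-set' n'-set'
           (⊎-map (map₂′ (agrees a b n-set')) (map₂′ (agrees a b n'-set')) t∈)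
  EpsS-agree n-set (eL a n p _ members) with shape 4 n n-set p
  ... | shL b n-set' = eL b n p n-set' (λ j j<ℓ → agrees a b n-set' (members j j<ℓ))
  EpsS-agree n-set (eId a n m k p _ m∈n t≡m m≡k) with shape 5 (pair3 n m k) n-set p
  ... | shId {n = n₂} {m = m₂} {k = k₂} b q n-set'
        with pair3-injective {n} {m} {k} {n₂} {m₂} {k₂} q
  ... | refl , refl , refl = eId b n m k p n-set' (agrees a b n-set' m∈n) t≡m m≡k
  EpsS-agree n-set (e◁ a a' s i c v p star a't∈V) with shape 6 (pair5 a' v s i c) n-set p
  ... | sh◁ {a = a₂} {s = s₂} {i = i₂} {c = c₂} {v = v₂} b q star'
        with pair5-injective {a'} {v} {s} {i} {c} {a₂} {v₂} {s₂} {i₂} {c₂} q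
  ... | refl , refl , refl , refl , refl = e◁ b a' s i c v p star'
        (Vset-agree (agrees a b) (agrees' a b) star star' a't∈V)

agree : ∀ α ρ → Agrees (lvl α) (lvl ρ)
agree (sup A f) (sup B g) = EpsS-agree (λ a b → agree (f a) (g b)) (λ a b → agree (g b) (f a))

mainTheorem4 :
    ((m : ℕ) (α ρ : 𝕍) → Ordinal α → Ordinal ρ → α ⊆ ρ →
       Setα α m → Setα ρ m)
    ×
    ((m : ℕ) (α ρ : 𝕍) → Ordinal α → Ordinal ρ →
       Setα α m → Setα ρ m →
       (i : ℕ) → (εα α i m → εα ρ i m) × (εα ρ i m → εα α i m))
mainTheorem4 =
  (λ _ α ρ _ _ α⊆ρ → Set-mono α ρ α⊆ρ) ,
  (λ _ α ρ _ _ α-set ρ-set _ → agree α ρ ρ-set , agree ρ α α-set)
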